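{- For every even integer $k\ge 4$ there exists an intersecting family $\mathcal{F}\subset\binom{[2k]}{k}$ such that $$\mathcal{D}(\mathcal{F})=\bigcup_{j=0}^{k-1}\binom{[2k]}{j}.$$
   Context: For a positive integer $m$, $[m]=\{1,\dots,m\}$. For a set $S$ and a non-negative integer $j$, $\binom{S}{j}$ denotes the family of all $j$-element subsets of $S$. For a family $\mathcal{F}$ of sets, $\mathcal{D}(\mathcal{F})=\{F\setminus F' : F,F'\in\mathcal{F}\}$ (the pair $F=F'$ is allowed, so $\emptyset\in\mathcal{D}(\mathcal{F})$ whenever $\mathcal{F}\neq\emptyset$). A family $\mathcal{F}$ is intersecting if $F\cap F'\neq\emptyset$ for all $F,F'\in\mathcal{F}$. -}

module Defs where

open import Data.Nat using (ℕ; _<_)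
open import Data.Fin.Subset using (Subset; _∩_; _─_; ∣_∣; Nonempty)
open import Data.List using (List)
open import Data.List.Membership.Propositional using (_∈_)
open import Data.Product using (∃₂; _×_)
open import Relation.Binary.PropositionalEquality using (_≡_)

Family : ℕ → Set
Family n = List (Subset n)

Uniform : ∀ {n} → ℕ → Family n → Set
Uniform k 𝓕 = ∀ {F} → F ∈ 𝓕 → ∣ F ∣ ≡ k

Intersecting : ∀ {n} → Family n → Set
Intersecting 𝓕 = ∀ {F F'} → F ∈ 𝓕 → F' ∈ 𝓕 → Nonempty (F ∩ F')

_∈D_ : ∀ {n} → Subset n → Family n → Set
S ∈D 𝓕 = ∃₂ λ F F' → F ∈ 𝓕 × F' ∈ 𝓕 × S ≡ F ─ F'

-- Colour every subset of [2k] red or blue so that complementary k-sets get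
-- opposite colours, and let 𝓕 be the red k-sets. Two k-sets of [2k] can only be
-- disjoint if they are complementary, so 𝓕 is intersecting and every F ∖ F' has
-- fewer than k elements; the work is to make every smaller set such a
-- difference. A suitable colouring of the subsets of [6] is checked by
-- exhaustive computation, and it is carried from [2k] to [2k+2] by adding two
-- points: a (k+1)-set takes the colour of its trace v on [2k] when v has k or
-- k−1 points, and the colour opposite to that of ∁v when v has k+1 points. The
-- step only goes through with three further invariants, which it reproduces:
-- every k-set has a lower cover of the other colour, every smaller set has upper
-- covers of both colours, and every S with |S| < j < k is A ∩ B for j-sets A, B
-- of opposite colours.

module Submission where

open import Defs
open import Data.Nat using (ℕ; _≤_; _<_; _*_)
open import Data.Nat.Divisibility using (_∣_)
open import Data.Fin.Subset using (Subset; ∣_∣)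
open import Data.Product using (Σ; _×_)
open import Function.Bundles using (_⇔_)

open import Data.Bool.Base using (Bool; true; false; not; if_then_else_)
open import Data.Bool.Properties using (not-involutive; not-injective; ∧-zeroʳ; ∧-identityʳ)
  renaming (_≟_ to _≟ᵇ_)
open import Data.Nat.Base using (zero; suc; _+_; s≤s)
open import Data.Nat.Properties
  using (_≟_; _<?_; suc-injective; 1+n≢n; +-suc; +-comm; +-identityʳ; +-cancelˡ-≡; m+[n∸m]≡n;
         ≤-reflexive; ≤-pred; ≤-trans; n≤1+n; n<1+n; ≤∧≢⇒<; <⇒≢; <-irrefl)
import Data.Fin.Base as Fin
open import Data.Fin.Subset using (∁; _∩_; _─_; Nonempty; inside; outside)
open import Data.Fin.Subset.Properties
  using (∩-comm; ∩-idem; ∣∁p∣≡n∸∣p∣; ∣p∣≤n; p∩q≢∅⇒∣p─q∣<∣p∣; anySubset?)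
open import Data.Vec.Base using ([]; _∷_; here; there)
open import Data.Vec.Properties using (≡-dec; map-∘; map-cong; map-id)
open import Data.List.Base as List using (List; []; _∷_; _++_; filter)
open import Data.List.Membership.Propositional using (_∈_)
open import Data.List.Membership.Propositional.Properties
  using (∈-++⁺ˡ; ∈-++⁺ʳ; ∈-map⁺; ∈-filter⁺; ∈-filter⁻)
import Data.List.Membership.DecPropositional as DecMembership
import Data.List.Relation.Unary.Any as Any
open import Data.Product using (∃; ∃₂; _,_; proj₁; proj₂)
open import Data.Sum as Sum using (_⊎_; inj₁; inj₂; [_,_]′)
open import Data.Empty using (⊥-elim)
open import Function.Base using (_∘_)
open import Function.Bundles using (mk⇔)
open import Relation.Binary.Definitions using (DecidableEquality) renaming (Decidable to Decidable₂)
open import Relation.Binary.PropositionalEquality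
  using (_≡_; _≢_; refl; sym; trans; cong; cong₂; subst; module ≡-Reasoning)
open import Relation.Nullary using (Dec; yes; no; does; ¬?)
open import Relation.Nullary.Decidable
  using (True; map′; _×-dec_; _→-dec_; toWitness; decidable-stable; dec-true; dec-false)
open import Relation.Unary using (Decidable)

private
  variable
    n k j : ℕ

pattern I = inside
pattern O = outside

opposite-hits : ∀ {x y} → x ≡ not y → ∀ b → x ≡ b ⊎ y ≡ b
opposite-hits {y = false} refl true  = inj₁ refl
opposite-hits {y = false} refl false = inj₂ refl
opposite-hits {y = true}  refl true  = inj₂ refl
opposite-hits {y = true}  refl false = inj₁ refl

m≡n⇒m≢1+n : ∀ {m n} → m ≡ n → m ≢ suc n
m≡n⇒m≢1+n m≡n m≡1+n = 1+n≢n (trans (sym m≡1+n) m≡n)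

_≟ₛ_ : DecidableEquality (Subset n)
_≟ₛ_ = ≡-dec _≟ᵇ_

∁-involutive : (p : Subset n) → ∁ (∁ p) ≡ p
∁-involutive p = trans (sym (map-∘ not not p)) (trans (map-cong not-involutive p) (map-id p))

∣p∣+∣∁p∣≡n : (p : Subset n) → ∣ p ∣ + ∣ ∁ p ∣ ≡ n
∣p∣+∣∁p∣≡n p = trans (cong (∣ p ∣ +_) (∣∁p∣≡n∸∣p∣ p)) (m+[n∸m]≡n (∣p∣≤n p))

∣p∣+j≡n⇒∣∁p∣≡j : (p : Subset n) → ∣ p ∣ + j ≡ n → ∣ ∁ p ∣ ≡ j
∣p∣+j≡n⇒∣∁p∣≡j p e = +-cancelˡ-≡ ∣ p ∣ _ _ (trans (∣p∣+∣∁p∣≡n p) (sym e))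

p─q≡p∩∁q : (p q : Subset n) → p ─ q ≡ p ∩ ∁ q
p─q≡p∩∁q []      []      = refl
p─q≡p∩∁q (x ∷ p) (I ∷ q) = cong₂ _∷_ (sym (∧-zeroʳ x)) (p─q≡p∩∁q p q)
p─q≡p∩∁q (x ∷ p) (O ∷ q) = cong₂ _∷_ (sym (∧-identityʳ x)) (p─q≡p∩∁q p q)

p─∁q≡p∩q : (p q : Subset n) → p ─ ∁ q ≡ p ∩ q
p─∁q≡p∩q p q = trans (p─q≡p∩∁q p (∁ q)) (cong (p ∩_) (∁-involutive q))

∁q∩p≡p─q : (p q : Subset n) → ∁ q ∩ p ≡ p ─ q
∁q∩p≡p─q p q = trans (∩-comm (∁ q) p) (sym (p─q≡p∩∁q p q))

∁p─p≡∁p : (p : Subset n) → ∁ p ─ p ≡ ∁ p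
∁p─p≡∁p p = trans (p─q≡p∩∁q (∁ p) p) (∩-idem (∁ p))

nonempty-∷ : ∀ {x} {p : Subset n} → Nonempty p → Nonempty (x ∷ p)
nonempty-∷ (i , i∈p) = Fin.suc i , there i∈p

meet-or-complement : (p q : Subset n) → n ≤ ∣ p ∣ + ∣ q ∣ → Nonempty (p ∩ q) ⊎ q ≡ ∁ p
meet-or-complement []      []      _        = inj₂ refl
meet-or-complement (I ∷ p) (I ∷ q) _        = inj₁ (Fin.zero , here)
meet-or-complement (I ∷ p) (O ∷ q) (s≤s n≤) =
  Sum.map nonempty-∷ (cong (O ∷_)) (meet-or-complement p q n≤)
meet-or-complement {suc n} (O ∷ p) (I ∷ q) n≤ =
  Sum.map nonempty-∷ (cong (I ∷_))
    (meet-or-complement p q (≤-pred (subst (suc n ≤_) (+-suc ∣ p ∣ ∣ q ∣) n≤)))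
meet-or-complement {suc n} (O ∷ p) (O ∷ q) n≤ with meet-or-complement p q (≤-trans (n≤1+n n) n≤)
... | inj₁ p∩q≢∅ = inj₁ (nonempty-∷ p∩q≢∅)
... | inj₂ refl  = ⊥-elim (<-irrefl refl (subst (suc n ≤_) (∣p∣+∣∁p∣≡n p) n≤))

allSubset? : {P : Subset n → Set} → Decidable P → Dec (∀ p → P p)
allSubset? P? = map′ (λ ¬∃¬P p → decidable-stable (P? p) (λ ¬Pp → ¬∃¬P (p , ¬Pp)))
                     (λ ∀P (p , ¬Pp) → ¬Pp (∀P p))
                     (¬? (anySubset? (¬? ∘ P?)))

subsets : ∀ n → List (Subset n)
subsets zero    = [] ∷ []
subsets (suc n) = List.map (I ∷_) (subsets n) ++ List.map (O ∷_) (subsets n)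

∈-subsets : (p : Subset n) → p ∈ subsets n
∈-subsets []              = Any.here refl
∈-subsets (I ∷ p)         = ∈-++⁺ˡ (∈-map⁺ (I ∷_) (∈-subsets p))
∈-subsets {suc n} (O ∷ p) = ∈-++⁺ʳ (List.map (I ∷_) (subsets n)) (∈-map⁺ (O ∷_) (∈-subsets p))

-- The covering relation of the subset lattice

infix 4 _⋖_ _⋖?_

data _⋖_ : Subset n → Subset n → Set where
  added : ∀ {p : Subset n} → O ∷ p ⋖ I ∷ p
  kept  : ∀ {x} {p q : Subset n} → p ⋖ q → x ∷ p ⋖ x ∷ q

_⋖?_ : Decidable₂ (_⋖_ {n})
[]      ⋖? []      = no λ ()
(O ∷ p) ⋖? (I ∷ q) = map′ (λ { refl → added }) (λ { added → refl }) (p ≟ₛ q)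
(I ∷ p) ⋖? (O ∷ q) = no λ ()
(O ∷ p) ⋖? (O ∷ q) = map′ kept (λ { (kept p⋖q) → p⋖q }) (p ⋖? q)
(I ∷ p) ⋖? (I ∷ q) = map′ kept (λ { (kept p⋖q) → p⋖q }) (p ⋖? q)

⋖-size : {p q : Subset n} → p ⋖ q → ∣ q ∣ ≡ suc ∣ p ∣
⋖-size added              = refl
⋖-size (kept {x = I} p⋖q) = cong suc (⋖-size p⋖q)
⋖-size (kept {x = O} p⋖q) = ⋖-size p⋖q

⋖-∁ : {p q : Subset n} → p ⋖ q → ∁ q ⋖ ∁ p
⋖-∁ added      = added
⋖-∁ (kept p⋖q) = kept (⋖-∁ p⋖q)

p⋖q⇒∁p─q≡∁q : {p q : Subset n} → p ⋖ q → ∁ p ─ q ≡ ∁ q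
p⋖q⇒∁p─q≡∁q (added {p = p})    = cong (O ∷_) (∁p─p≡∁p p)
p⋖q⇒∁p─q≡∁q (kept {x = I} p⋖q) = cong (O ∷_) (p⋖q⇒∁p─q≡∁q p⋖q)
p⋖q⇒∁p─q≡∁q (kept {x = O} p⋖q) = cong (I ∷_) (p⋖q⇒∁p─q≡∁q p⋖q)

p⋖q⇒∁q─p≡∁q : {p q : Subset n} → p ⋖ q → ∁ q ─ p ≡ ∁ q
p⋖q⇒∁q─p≡∁q (added {p = p})    = cong (O ∷_) (∁p─p≡∁p p)
p⋖q⇒∁q─p≡∁q (kept {x = I} p⋖q) = cong (O ∷_) (p⋖q⇒∁q─p≡∁q p⋖q)
p⋖q⇒∁q─p≡∁q (kept {x = O} p⋖q) = cong (I ∷_) (p⋖q⇒∁q─p≡∁q p⋖q)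

-- Not k + k: Subset (double (suc k)) has to unfold to two new points in front
-- of a Subset (double k).
double : ℕ → ℕ
double zero    = zero
double (suc k) = suc (suc (double k))

double≡+ : ∀ k → double k ≡ k + k
double≡+ zero    = refl
double≡+ (suc k) = cong suc (trans (cong suc (double≡+ k)) (sym (+-suc k k)))

double≡2* : ∀ k → double k ≡ 2 * k
double≡2* k = trans (double≡+ k) (cong (k +_) (sym (+-identityʳ k)))

Colouring : ℕ → Set
Colouring n = Subset n → Bool

Red : Colouring n → ℕ → Subset n → Set
Red χ k F = ∣ F ∣ ≡ k × χ F ≡ true

red? : (χ : Colouring n) (k : ℕ) → Decidable (Red χ k)
red? χ k F = (∣ F ∣ ≟ k) ×-dec (χ F ≟ᵇ true)

Antipodal : Colouring n → ℕ → Set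
Antipodal χ k = ∀ A → ∣ A ∣ ≡ k → χ (∁ A) ≡ not (χ A)

RedDifference : Colouring n → ℕ → Subset n → Set
RedDifference χ k S = ∃₂ λ F F' → Red χ k F × Red χ k F' × S ≡ F ─ F'

OppositeLowerCover : Colouring n → Subset n → Set
OppositeLowerCover χ A = ∃ λ C → C ⋖ A × χ C ≡ not (χ A)

OppositeUpperCovers : Colouring n → Subset n → Set
OppositeUpperCovers χ D = ∃₂ λ C C' → D ⋖ C × D ⋖ C' × χ C ≡ not (χ C')

OppositeMeet : Colouring n → ℕ → Subset n → Set
OppositeMeet χ j S = ∃₂ λ A B → ∣ A ∣ ≡ j × ∣ B ∣ ≡ j × A ∩ B ≡ S × χ A ≡ not (χ B)

redDifference? : (χ : Colouring n) (k : ℕ) → Decidable (RedDifference χ k)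
redDifference? χ k S =
  anySubset? λ F → anySubset? λ F' → red? χ k F ×-dec red? χ k F' ×-dec S ≟ₛ (F ─ F')

oppositeLowerCover? : (χ : Colouring n) → Decidable (OppositeLowerCover χ)
oppositeLowerCover? χ A = anySubset? λ C → (C ⋖? A) ×-dec (χ C ≟ᵇ not (χ A))

oppositeUpperCovers? : (χ : Colouring n) → Decidable (OppositeUpperCovers χ)
oppositeUpperCovers? χ D =
  anySubset? λ C → anySubset? λ C' → (D ⋖? C) ×-dec (D ⋖? C') ×-dec (χ C ≟ᵇ not (χ C'))

oppositeMeet? : (χ : Colouring n) (j : ℕ) → Decidable (OppositeMeet χ j)
oppositeMeet? χ j S =
  anySubset? λ A → anySubset? λ B →
    (∣ A ∣ ≟ j) ×-dec (∣ B ∣ ≟ j) ×-dec ((A ∩ B) ≟ₛ S) ×-dec (χ A ≟ᵇ not (χ B))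

record Admissible (k : ℕ) (χ : Colouring (double k)) : Set where
  field
    antipodal     : Antipodal χ k
    redDifference : ∀ S → ∣ S ∣ < k → RedDifference χ k S
    oppositeLower : ∀ A → ∣ A ∣ ≡ k → OppositeLowerCover χ A
    oppositeUpper : ∀ D → ∣ D ∣ < k → OppositeUpperCovers χ D
    oppositeMeet  : ∀ j → j < k → ∀ S → ∣ S ∣ < j → OppositeMeet χ j S

redFamily : Colouring n → ℕ → Family n
redFamily {n} χ k = filter (red? χ k) (subsets n)

module _ {χ : Colouring n} {k : ℕ} {F : Subset n} where

  ∈-redFamily⁺ : Red χ k F → F ∈ redFamily χ k
  ∈-redFamily⁺ = ∈-filter⁺ (red? χ k) (∈-subsets F)

  ∈-redFamily⁻ : F ∈ redFamily χ k → Red χ k F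
  ∈-redFamily⁻ F∈ = proj₂ (∈-filter⁻ (red? χ k) {xs = subsets n} F∈)

redFamily-uniform : {χ : Colouring n} → Uniform k (redFamily χ k)
redFamily-uniform = proj₁ ∘ ∈-redFamily⁻

redFamily-intersecting : {χ : Colouring (double k)} → Antipodal χ k → Intersecting (redFamily χ k)
redFamily-intersecting {k} {χ} antipodal {F} {F'} F∈ F'∈
  with ∈-redFamily⁻ F∈ | ∈-redFamily⁻ F'∈
... | ∣F∣≡k , χF | ∣F'∣≡k , χF'
  with meet-or-complement F F' (≤-reflexive (trans (double≡+ k) (sym (cong₂ _+_ ∣F∣≡k ∣F'∣≡k))))
... | inj₁ F∩F'≢∅ = F∩F'≢∅
... | inj₂ F'≡∁F  = ⊥-elim (true≢false (begin
    true        ≡⟨ sym χF' ⟩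
    χ F'        ≡⟨ cong χ F'≡∁F ⟩
    χ (∁ F)     ≡⟨ antipodal F ∣F∣≡k ⟩
    not (χ F)   ≡⟨ cong not χF ⟩
    false       ∎))
  where
  open ≡-Reasoning
  true≢false : true ≢ false
  true≢false ()

redFamily-differences : {χ : Colouring (double k)} → Antipodal χ k →
                        (∀ S → ∣ S ∣ < k → RedDifference χ k S) →
                        ∀ S → S ∈D redFamily χ k ⇔ ∣ S ∣ < k
redFamily-differences {k} antipodal redDifference S = mk⇔ short (long ∘ redDifference S)
  where
  short : S ∈D redFamily _ k → ∣ S ∣ < k
  short (F , F' , F∈ , F'∈ , refl) =
    subst (∣ F ─ F' ∣ <_) (proj₁ (∈-redFamily⁻ F∈))
          (p∩q≢∅⇒∣p─q∣<∣p∣ F F' (redFamily-intersecting antipodal F∈ F'∈))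
  long : RedDifference _ k S → S ∈D redFamily _ k
  long (F , F' , redF , redF' , S≡) = F , F' , ∈-redFamily⁺ redF , ∈-redFamily⁺ redF' , S≡

FullDifferenceFamily : ℕ → ℕ → Set
FullDifferenceFamily n k =
  Σ (Family n) λ 𝓕 → Uniform k 𝓕 × Intersecting 𝓕 × ((S : Subset n) → (S ∈D 𝓕) ⇔ (∣ S ∣ < k))

admissible⇒fullDifferenceFamily : {χ : Colouring (double k)} →
                                  Admissible k χ → FullDifferenceFamily (double k) k
admissible⇒fullDifferenceFamily {k} {χ} adm =
  redFamily χ k , redFamily-uniform , redFamily-intersecting antipodal ,
  redFamily-differences antipodal redDifference
  where open Admissible adm

-- Adding two points

extend : ∀ {k} → Colouring (double k) → Colouring (double (suc k))
extend {k} χ (I ∷ O ∷ v) = if does (∣ v ∣ ≟ k) then χ v else not (χ v)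
extend     χ (O ∷ I ∷ v) = χ v
extend     χ (I ∷ I ∷ v) = χ v
extend {k} χ (O ∷ O ∷ v) = if does (∣ v ∣ ≟ suc k) then not (χ (∁ v)) else not (χ v)

module _ {k : ℕ} (χ : Colouring (double k)) where

  extend-IO : ∀ {v} → ∣ v ∣ ≡ k → extend χ (I ∷ O ∷ v) ≡ χ v
  extend-IO {v} e rewrite dec-true (∣ v ∣ ≟ k) e = refl

  extend-IO-≢ : ∀ {v} → ∣ v ∣ ≢ k → extend χ (I ∷ O ∷ v) ≡ not (χ v)
  extend-IO-≢ {v} e rewrite dec-false (∣ v ∣ ≟ k) e = refl

  extend-OO : ∀ {v} → ∣ v ∣ ≡ suc k → extend χ (O ∷ O ∷ v) ≡ not (χ (∁ v))
  extend-OO {v} e rewrite dec-true (∣ v ∣ ≟ suc k) e = refl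

  extend-OO-≢ : ∀ {v} → ∣ v ∣ ≢ suc k → extend χ (O ∷ O ∷ v) ≡ not (χ v)
  extend-OO-≢ {v} e rewrite dec-false (∣ v ∣ ≟ suc k) e = refl

  extend-IO-opposite : ∀ {C C'} → ∣ C ∣ ≡ ∣ C' ∣ → χ C ≡ not (χ C') →
                       extend χ (I ∷ O ∷ C) ≡ not (extend χ (I ∷ O ∷ C'))
  extend-IO-opposite {C} {C'} same opp with ∣ C ∣ ≟ k
  ... | yes e = trans (extend-IO e)
                  (trans opp (cong not (sym (extend-IO {C'} (trans (sym same) e)))))
  ... | no e  = trans (extend-IO-≢ e)
                  (cong not (trans opp (sym (extend-IO-≢ {C'} (e ∘ trans same)))))

  extend-OO-opposite : ∀ {C C'} → ∣ C ∣ ≡ ∣ C' ∣ → ∣ C ∣ ≢ suc k → χ C ≡ not (χ C') →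
                       extend χ (O ∷ O ∷ C) ≡ not (extend χ (O ∷ O ∷ C'))
  extend-OO-opposite {C} {C'} same e opp =
    trans (extend-OO-≢ e) (cong not (trans opp (sym (extend-OO-≢ {C'} (e ∘ trans same)))))

module Extension {k : ℕ} {χ : Colouring (double (suc k))} (adm : Admissible (suc k) χ) where
  open Admissible adm
  open ≡-Reasoning

  χ⁺ : Colouring (double (suc (suc k)))
  χ⁺ = extend χ

  ∁-top : ∀ v → ∣ v ∣ ≡ suc k → ∣ ∁ v ∣ ≡ suc k
  ∁-top v e = ∣p∣+j≡n⇒∣∁p∣≡j v (trans (cong (_+ suc k) e) (sym (double≡+ (suc k))))

  ∁-below : ∀ v → ∣ v ∣ ≡ k → ∣ ∁ v ∣ ≡ suc (suc k)
  ∁-below v e = ∣p∣+j≡n⇒∣∁p∣≡j v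
    (trans (cong (_+ suc (suc k)) e) (trans (+-suc k (suc k)) (sym (double≡+ (suc k)))))

  ∁-above : ∀ v → ∣ v ∣ ≡ suc (suc k) → ∣ ∁ v ∣ ≡ k
  ∁-above v e = ∣p∣+j≡n⇒∣∁p∣≡j v
    (trans (cong (_+ k) e) (trans (+-comm (suc (suc k)) k)
      (trans (+-suc k (suc k)) (sym (double≡+ (suc k))))))

  lowerCover-size : ∀ {C} v → ∣ v ∣ ≡ suc k → C ⋖ ∁ v → ∣ C ∣ ≡ k
  lowerCover-size v e C⋖∁v = suc-injective (trans (sym (⋖-size C⋖∁v)) (∁-top v e))

  χ⁺-OO∁-top : ∀ X → ∣ X ∣ ≡ suc k → χ⁺ (O ∷ O ∷ ∁ X) ≡ χ X
  χ⁺-OO∁-top X e = begin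
    χ⁺ (O ∷ O ∷ ∁ X)  ≡⟨ extend-OO-≢ χ (m≡n⇒m≢1+n (∁-top X e)) ⟩
    not (χ (∁ X))     ≡⟨ cong not (antipodal X e) ⟩
    not (not (χ X))   ≡⟨ not-involutive (χ X) ⟩
    χ X               ∎

  χ⁺-OO∁-below : ∀ X → ∣ X ∣ ≡ k → χ⁺ (O ∷ O ∷ ∁ X) ≡ not (χ X)
  χ⁺-OO∁-below X e = trans (extend-OO χ (∁-below X e)) (cong (not ∘ χ) (∁-involutive X))

  red-IO : ∀ {F} → Red χ (suc k) F → Red χ⁺ (suc (suc k)) (I ∷ O ∷ F)
  red-IO (∣F∣ , χF) = cong suc ∣F∣ , trans (extend-IO χ ∣F∣) χF

  red-OI : ∀ {F} → Red χ (suc k) F → Red χ⁺ (suc (suc k)) (O ∷ I ∷ F)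
  red-OI (∣F∣ , χF) = cong suc ∣F∣ , χF

  upperCover-coloured : ∀ D → ∣ D ∣ < suc k → ∀ b → ∃ λ C → D ⋖ C × χ C ≡ b
  upperCover-coloured D lt b with oppositeUpper D lt
  ... | C , C' , D⋖C , D⋖C' , opp =
    [ (λ χC≡b → C , D⋖C , χC≡b) , (λ χC'≡b → C' , D⋖C' , χC'≡b) ]′ (opposite-hits opp b)

  oppositeMeet-red-blue : ∀ j → j < suc k → ∀ S → ∣ S ∣ < j →
    ∃₂ λ A B → ∣ A ∣ ≡ j × ∣ B ∣ ≡ j × A ∩ B ≡ S × χ A ≡ true × χ B ≡ false
  oppositeMeet-red-blue j j< S S< with oppositeMeet j j< S S<
  ... | A , B , ∣A∣ , ∣B∣ , A∩B , opp with χ B in χB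
  ...   | false = A , B , ∣A∣ , ∣B∣ , A∩B , opp , χB
  ...   | true  = B , A , ∣B∣ , ∣A∣ , trans (∩-comm B A) A∩B , χB , opp

  antipodal⁺ : Antipodal χ⁺ (suc (suc k))
  antipodal⁺ (I ∷ O ∷ v) e =
    trans (antipodal v (suc-injective e)) (cong not (sym (extend-IO χ (suc-injective e))))
  antipodal⁺ (O ∷ I ∷ v) e =
    trans (extend-IO χ (∁-top v (suc-injective e))) (antipodal v (suc-injective e))
  antipodal⁺ (I ∷ I ∷ v) e = χ⁺-OO∁-below v (suc-injective (suc-injective e))
  antipodal⁺ (O ∷ O ∷ v) e = trans (sym (not-involutive _)) (cong not (sym (extend-OO χ e)))

  oppositeLower⁺ : ∀ A → ∣ A ∣ ≡ suc (suc k) → OppositeLowerCover χ⁺ A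
  oppositeLower⁺ (I ∷ O ∷ v) e =
    O ∷ O ∷ v , added ,
    trans (extend-OO-≢ χ (m≡n⇒m≢1+n (suc-injective e))) (cong not (sym (extend-IO χ (suc-injective e))))
  oppositeLower⁺ (O ∷ I ∷ v) e = O ∷ O ∷ v , kept added , extend-OO-≢ χ (m≡n⇒m≢1+n (suc-injective e))
  oppositeLower⁺ (I ∷ I ∷ v) e =
    I ∷ O ∷ v , kept added , extend-IO-≢ χ (m≡n⇒m≢1+n (suc-injective (suc-injective e)))
  oppositeLower⁺ (O ∷ O ∷ v) e
    with upperCover-coloured (∁ v) (≤-reflexive (cong suc (∁-above v e))) (χ (∁ v))
  ... | C , ∁v⋖C , χC≡χ∁v = O ∷ O ∷ ∁ C , kept (kept ∁C⋖v) , (begin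
    χ⁺ (O ∷ O ∷ ∁ C)          ≡⟨ χ⁺-OO∁-top C (trans (⋖-size ∁v⋖C) (cong suc (∁-above v e))) ⟩
    χ C                       ≡⟨ χC≡χ∁v ⟩
    χ (∁ v)                   ≡⟨ not-involutive (χ (∁ v)) ⟨
    not (not (χ (∁ v)))       ≡⟨ cong not (extend-OO χ e) ⟨
    not (χ⁺ (O ∷ O ∷ v))      ∎)
    where
    ∁C⋖v : ∁ C ⋖ v
    ∁C⋖v = subst (∁ C ⋖_) (∁-involutive v) (⋖-∁ ∁v⋖C)

  oppositeUpper⁺ : ∀ D → ∣ D ∣ < suc (suc k) → OppositeUpperCovers χ⁺ D
  oppositeUpper⁺ (O ∷ O ∷ v) _ with ∣ v ∣ ≟ suc k
  ... | no ∣v∣≢ = I ∷ O ∷ v , O ∷ I ∷ v , added , kept added , extend-IO-≢ χ ∣v∣≢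
  ... | yes e with oppositeLower (∁ v) (∁-top v e)
  ...   | C , C⋖∁v , χC = O ∷ O ∷ ∁ C , I ∷ O ∷ v , kept (kept v⋖∁C) , added , (begin
    χ⁺ (O ∷ O ∷ ∁ C)      ≡⟨ χ⁺-OO∁-below C (lowerCover-size v e C⋖∁v) ⟩
    not (χ C)             ≡⟨ cong not χC ⟩
    not (not (χ (∁ v)))   ≡⟨ not-involutive (χ (∁ v)) ⟩
    χ (∁ v)               ≡⟨ antipodal v e ⟩
    not (χ v)             ≡⟨ cong not (extend-IO χ e) ⟨
    not (χ⁺ (I ∷ O ∷ v))  ∎)
    where
    v⋖∁C : v ⋖ ∁ C
    v⋖∁C = subst (_⋖ ∁ C) (∁-involutive v) (⋖-∁ C⋖∁v)
  oppositeUpper⁺ (I ∷ O ∷ v) (s≤s lt) with oppositeUpper v lt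
  ... | C , C' , v⋖C , v⋖C' , opp =
    I ∷ O ∷ C , I ∷ O ∷ C' , kept (kept v⋖C) , kept (kept v⋖C') ,
    extend-IO-opposite χ (trans (⋖-size v⋖C) (sym (⋖-size v⋖C'))) opp
  oppositeUpper⁺ (O ∷ I ∷ v) (s≤s lt) with oppositeUpper v lt
  ... | C , C' , v⋖C , v⋖C' , opp = O ∷ I ∷ C , O ∷ I ∷ C' , kept (kept v⋖C) , kept (kept v⋖C') , opp
  oppositeUpper⁺ (I ∷ I ∷ v) (s≤s lt) with oppositeUpper v (≤-trans (n≤1+n _) lt)
  ... | C , C' , v⋖C , v⋖C' , opp = I ∷ I ∷ C , I ∷ I ∷ C' , kept (kept v⋖C) , kept (kept v⋖C') , opp

  oppositeMeet⁺ : ∀ j → j < suc (suc k) → ∀ S → ∣ S ∣ < j → OppositeMeet χ⁺ j S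
  oppositeMeet⁺ j j< (O ∷ O ∷ v) v< with j ≟ suc k
  ... | no j≢ with oppositeMeet j (≤∧≢⇒< (≤-pred j<) j≢) v v<
  ...   | A , B , ∣A∣ , ∣B∣ , A∩B , opp =
    O ∷ O ∷ A , O ∷ O ∷ B , ∣A∣ , ∣B∣ , cong (λ w → O ∷ O ∷ w) A∩B ,
    extend-OO-opposite χ (trans ∣A∣ (sym ∣B∣)) (<⇒≢ (subst (_< suc (suc k)) (sym ∣A∣) j<)) opp
  oppositeMeet⁺ j j< (O ∷ O ∷ v) v< | yes refl with redDifference v v<
  ... | F , F' , (∣F∣ , χF) , (∣F'∣ , χF') , v≡F─F' =
    O ∷ O ∷ ∁ F' , O ∷ O ∷ F , ∁-top F' ∣F'∣ , ∣F∣ ,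
    cong (λ w → O ∷ O ∷ w) (trans (∁q∩p≡p─q F F') (sym v≡F─F')) , (begin
    χ⁺ (O ∷ O ∷ ∁ F')      ≡⟨ χ⁺-OO∁-top F' ∣F'∣ ⟩
    χ F'                   ≡⟨ trans χF' (sym χF) ⟩
    χ F                    ≡⟨ not-involutive (χ F) ⟨
    not (not (χ F))        ≡⟨ cong not (extend-OO-≢ χ (m≡n⇒m≢1+n ∣F∣)) ⟨
    not (χ⁺ (O ∷ O ∷ F))   ∎)
  oppositeMeet⁺ (suc j) (s≤s j<) (I ∷ O ∷ v) (s≤s v<) with oppositeMeet j j< v v<
  ... | A , B , ∣A∣ , ∣B∣ , A∩B , opp =
    I ∷ O ∷ A , I ∷ O ∷ B , cong suc ∣A∣ , cong suc ∣B∣ , cong (λ w → I ∷ O ∷ w) A∩B ,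
    extend-IO-opposite χ (trans ∣A∣ (sym ∣B∣)) opp
  oppositeMeet⁺ (suc j) (s≤s j<) (O ∷ I ∷ v) (s≤s v<) with oppositeMeet j j< v v<
  ... | A , B , ∣A∣ , ∣B∣ , A∩B , opp =
    O ∷ I ∷ A , O ∷ I ∷ B , cong suc ∣A∣ , cong suc ∣B∣ , cong (λ w → O ∷ I ∷ w) A∩B , opp
  oppositeMeet⁺ (suc (suc j)) (s≤s j<) (I ∷ I ∷ v) (s≤s (s≤s v<))
    with oppositeMeet j (≤-trans (n≤1+n _) j<) v v<
  ... | A , B , ∣A∣ , ∣B∣ , A∩B , opp =
    I ∷ I ∷ A , I ∷ I ∷ B , cong (λ x → suc (suc x)) ∣A∣ , cong (λ x → suc (suc x)) ∣B∣ ,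
    cong (λ w → I ∷ I ∷ w) A∩B , opp

  redDifference-boundary : ∀ v → ∣ v ∣ ≡ suc k → RedDifference χ⁺ (suc (suc k)) (O ∷ O ∷ v)
  redDifference-boundary v e with oppositeLower (∁ v) (∁-top v e)
  ... | C , C⋖∁v , χC with χ (∁ v) in χ∁v
  ...   | true =
    O ∷ O ∷ ∁ C , O ∷ I ∷ ∁ v ,
    (∁-below C ∣C∣ , trans (χ⁺-OO∁-below C ∣C∣) (cong not χC)) ,
    (cong suc (∁-top v e) , χ∁v) ,
    cong (λ w → O ∷ O ∷ w) (sym (trans (p⋖q⇒∁p─q≡∁q C⋖∁v) (∁-involutive v)))
    where ∣C∣ = lowerCover-size v e C⋖∁v
  ...   | false =
    I ∷ O ∷ v , I ∷ I ∷ C ,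
    red-IO (e , not-injective {χ v} {true} (trans (sym (antipodal v e)) χ∁v)) ,
    (cong (λ x → suc (suc x)) (lowerCover-size v e C⋖∁v) , χC) ,
    cong (λ w → O ∷ O ∷ w) (sym (subst (λ w → w ─ C ≡ w) (∁-involutive v) (p⋖q⇒∁q─p≡∁q C⋖∁v)))

  redDifference⁺ : ∀ S → ∣ S ∣ < suc (suc k) → RedDifference χ⁺ (suc (suc k)) S
  redDifference⁺ (O ∷ O ∷ v) v< with ∣ v ∣ ≟ suc k
  ... | yes e = redDifference-boundary v e
  ... | no ∣v∣≢ with redDifference v (≤∧≢⇒< (≤-pred v<) ∣v∣≢)
  ...   | F , F' , redF , redF' , v≡ =
    I ∷ O ∷ F , I ∷ O ∷ F' , red-IO redF , red-IO redF' , cong (λ w → O ∷ O ∷ w) v≡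
  redDifference⁺ (I ∷ O ∷ v) (s≤s v<) with redDifference v v<
  ... | F , F' , redF , redF' , v≡ =
    I ∷ O ∷ F , O ∷ I ∷ F' , red-IO redF , red-OI redF' , cong (λ w → I ∷ O ∷ w) v≡
  redDifference⁺ (O ∷ I ∷ v) (s≤s v<) with redDifference v v<
  ... | F , F' , redF , redF' , v≡ =
    O ∷ I ∷ F , I ∷ O ∷ F' , red-OI redF , red-IO redF' , cong (λ w → O ∷ I ∷ w) v≡
  redDifference⁺ (I ∷ I ∷ v) (s≤s v<) with oppositeMeet-red-blue k (n<1+n k) v (≤-pred v<)
  ... | A , B , ∣A∣ , ∣B∣ , A∩B , χA , χB =
    I ∷ I ∷ A , O ∷ O ∷ ∁ B ,
    (cong (λ x → suc (suc x)) ∣A∣ , χA) , (∁-below B ∣B∣ , trans (χ⁺-OO∁-below B ∣B∣) (cong not χB)) ,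
    cong (λ w → I ∷ I ∷ w) (sym (trans (p─∁q≡p∩q A B) A∩B))

extend-admissible : {χ : Colouring (double (suc k))} →
                    Admissible (suc k) χ → Admissible (suc (suc k)) (extend χ)
extend-admissible adm = record
  { antipodal     = antipodal⁺
  ; redDifference = redDifference⁺
  ; oppositeLower = oppositeLower⁺
  ; oppositeUpper = oppositeUpper⁺
  ; oppositeMeet  = oppositeMeet⁺
  }
  where open Extension adm

-- The base case k = 3

redBase : List (Subset 6)
redBase =
  (I ∷ I ∷ O ∷ O ∷ I ∷ O ∷ []) ∷ (I ∷ I ∷ O ∷ O ∷ O ∷ I ∷ []) ∷ (I ∷ O ∷ I ∷ I ∷ O ∷ O ∷ []) ∷
  (O ∷ I ∷ I ∷ I ∷ O ∷ O ∷ []) ∷ (O ∷ I ∷ I ∷ O ∷ I ∷ O ∷ []) ∷ (O ∷ I ∷ I ∷ O ∷ O ∷ I ∷ []) ∷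
  (O ∷ I ∷ O ∷ I ∷ I ∷ O ∷ []) ∷ (O ∷ I ∷ O ∷ I ∷ O ∷ I ∷ []) ∷ (O ∷ O ∷ I ∷ O ∷ I ∷ I ∷ []) ∷
  (O ∷ O ∷ O ∷ I ∷ I ∷ I ∷ []) ∷
  (I ∷ O ∷ O ∷ I ∷ O ∷ O ∷ []) ∷ (I ∷ O ∷ O ∷ O ∷ I ∷ O ∷ []) ∷ (I ∷ O ∷ O ∷ O ∷ O ∷ I ∷ []) ∷
  (O ∷ I ∷ I ∷ O ∷ O ∷ O ∷ []) ∷ (O ∷ I ∷ O ∷ O ∷ I ∷ O ∷ []) ∷ (O ∷ O ∷ I ∷ I ∷ O ∷ O ∷ []) ∷
  (I ∷ O ∷ O ∷ O ∷ O ∷ O ∷ []) ∷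
  []

χ₃ : Colouring (double 3)
χ₃ A = does (A ∈? redBase)
  where open DecMembership _≟ₛ_ using (_∈?_)

by-computation : {P : Subset n → Set} (P? : Decidable P) → {True (allSubset? P?)} → ∀ p → P p
by-computation P? {holds} = toWitness holds

admissible₃ : Admissible 3 χ₃
admissible₃ = record
  { antipodal     = by-computation λ A → (∣ A ∣ ≟ 3) →-dec (χ₃ (∁ A) ≟ᵇ not (χ₃ A))
  ; redDifference = by-computation λ S → (∣ S ∣ <? 3) →-dec redDifference? χ₃ 3 S
  ; oppositeLower = by-computation λ A → (∣ A ∣ ≟ 3) →-dec oppositeLowerCover? χ₃ A
  ; oppositeUpper = by-computation λ D → (∣ D ∣ <? 3) →-dec oppositeUpperCovers? χ₃ D
  ; oppositeMeet  = oppositeMeet₃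
  }
  where
  oppositeMeet₃ : ∀ j → j < 3 → ∀ S → ∣ S ∣ < j → OppositeMeet χ₃ j S
  oppositeMeet₃ 0 _ S ()
  oppositeMeet₃ 1 _ = by-computation λ S → (∣ S ∣ <? 1) →-dec oppositeMeet? χ₃ 1 S
  oppositeMeet₃ 2 _ = by-computation λ S → (∣ S ∣ <? 2) →-dec oppositeMeet? χ₃ 2 S
  oppositeMeet₃ (suc (suc (suc _))) (s≤s (s≤s (s≤s ())))

colouring : ∀ m → Colouring (double (3 + m))
colouring zero    = χ₃
colouring (suc m) = extend (colouring m)

colouring-admissible : ∀ m → Admissible (3 + m) (colouring m)
colouring-admissible zero    = admissible₃
colouring-admissible (suc m) = extend-admissible (colouring-admissible m)

fullDifferenceFamily : ∀ k → 3 ≤ k → FullDifferenceFamily (double k) k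
fullDifferenceFamily (suc (suc (suc m))) (s≤s (s≤s (s≤s _))) =
  admissible⇒fullDifferenceFamily (colouring-admissible m)

theorem1p1 : (k : ℕ) → 2 ∣ k → 4 ≤ k →
    Σ (Family (2 * k)) λ 𝓕 →
      Uniform k 𝓕 × Intersecting 𝓕 ×
      ((S : Subset (2 * k)) → (S ∈D 𝓕) ⇔ (∣ S ∣ < k))
theorem1p1 k _ 4≤k =
  subst (λ n → FullDifferenceFamily n k) (double≡2* k) (fullDifferenceFamily k (≤-trans (n≤1+n 3) 4≤k))
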